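{- Let $(M,\to)$ be a transition system and $P\Rightarrow Q$ a reachability predicate. Then $(M,\to)\models^\forall P\Rightarrow Q$ if and only if every execution path $\tau$ with $\mathit{hd}(\tau)\in P$ satisfies $P\Rightarrow Q$ (i.e. $\tau\models^\forall P\Rightarrow Q$).
   Context: $(M,\to)$: a set $M$ with ${\to}\subseteq M\times M$; $\gamma$ is irreducible if it has no successor. Execution paths are coinductively defined (greatest fixed point) by: $\gamma$ is a path if $\gamma$ is irreducible; $\gamma_0\cdot\tau$ is a path if $\tau$ is a path and $\gamma_0\to\mathit{hd}(\tau)$, where $\mathit{hd}(\gamma)=\gamma$ and $\mathit{hd}(\gamma_0\cdot\tau)=\gamma_0$ (so paths are the finite paths ending in an irreducible state and the infinite paths). For $P\subseteq M$, $\partial(P)=\{\gamma'\mid\gamma\to\gamma'\text{ for some }\gamma\in P\}$; $P$ is runnable if $P\neq\emptyset$ and every $\gamma\in P$ has a successor. A reachability predicate is a pair $P\Rightarrow Q$ of subsets of $M$. $\tau\models^\forall P\Rightarrow Q$ iff $\langle\tau,P\Rightarrow Q\rangle$ is in the greatest fixed point of the rules: $\langle\tau,P\Rightarrow Q\rangle$ with no premise if $\mathit{hd}(\tau)\in P\cap Q$; from $\langle\tau,\partial(P)\Rightarrow Q\rangle$ infer $\langle\gamma_0\cdot\tau,P\Rightarrow Q\rangle$ if $\gamma_0\in P$ and $\gamma_0\to\mathit{hd}(\tau)$. $(M,\to)\models^\forall P\Rightarrow Q$ (demonic validity) iff $P\Rightarrow Q$ is in the greatest fixed point of: (Subsumption)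 $P\Rightarrow Q$ with no premise if $P\subseteq Q$; (Step) from $\partial(P\setminus Q)\Rightarrow Q$ infer $P\Rightarrow Q$ if $P\setminus Q$ is runnable. -}

module Defs where

open import Level using (0ℓ)
open import Data.Nat using (ℕ; zero; suc)
open import Data.Maybe using (Maybe; just; nothing)
open import Data.Product using (Σ; ∃; _×_; _,_)
open import Data.Sum using (_⊎_)
open import Relation.Nullary using (¬_)
open import Relation.Unary using (Pred; _∈_; _∉_; _⊆_)
open import Relation.Binary.PropositionalEquality using (_≡_)

-- Execution sequences: finite non-empty or infinite sequences of states,
-- i.e. the carrier  γ | γ₀ · τ  of the (coinductive) path definition.
-- A sequence is its head plus the partial list of further states
-- rest 0, rest 1, … ; once 'nothing' occurs the sequence has ended.

record Seq (M : Set) : Set where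
  constructor mkSeq
  field
    hd     : M
    rest   : ℕ → Maybe M
    closed : ∀ n → rest n ≡ nothing → rest (suc n) ≡ nothing

open Seq public

[_] : {M : Set} → M → Seq M
[ γ ] = mkSeq γ (λ _ → nothing) (λ _ e → e)

-- if  rest τ 0 ≡ just x  then  τ = hd τ · tail τ x  (and hd (tail τ x) = x)
tail : {M : Set} → Seq M → M → Seq M
tail τ x = mkSeq x (λ n → rest τ (suc n)) (λ n → closed τ (suc n))

module _ {M : Set} (_⟶_ : M → M → Set) where

  Irreducible : M → Set
  Irreducible γ = ¬ (∃ λ γ′ → γ ⟶ γ′)

  ∂ : Pred M 0ℓ → Pred M 0ℓ
  ∂ P γ′ = ∃ λ γ → γ ∈ P × γ ⟶ γ′

  _∖_ : Pred M 0ℓ → Pred M 0ℓ → Pred M 0ℓ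
  (P ∖ Q) γ = γ ∈ P × γ ∉ Q

  Runnable : Pred M 0ℓ → Set
  Runnable P = (∃ λ γ → γ ∈ P) × (∀ γ → γ ∈ P → ∃ λ γ′ → γ ⟶ γ′)

  -- Greatest fixed points are given by Knaster–Tarski: x ∈ νF iff x ∈ R
  -- for some post-fixed point R ⊆ F(R) (R ranging over Set₁-valued
  -- relations, so that relations mentioning predicates are allowed).  Each F below is the one-step
  -- rule operator, with a sequence  γ₀ · τ  read as  hd σ · tail σ x
  -- (when  rest σ 0 ≡ just x) and  γ  read as  rest σ 0 ≡ nothing.

  PathF : (Seq M → Set₁) → (Seq M → Set₁)
  PathF R σ =
      (rest σ 0 ≡ nothing × Irreducible (hd σ))
    ⊎ (Σ M λ x → rest σ 0 ≡ just x × hd σ ⟶ x × R (tail σ x))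

  IsPath : Seq M → Set₂
  IsPath τ = Σ (Seq M → Set₁) λ R → (∀ σ → R σ → PathF R σ) × R τ

  SatF : (Seq M → Pred M 0ℓ → Pred M 0ℓ → Set₁)
       → (Seq M → Pred M 0ℓ → Pred M 0ℓ → Set₁)
  SatF R σ P Q =
      (hd σ ∈ P × hd σ ∈ Q)
    ⊎ (Σ M λ x → rest σ 0 ≡ just x × hd σ ∈ P × hd σ ⟶ x × R (tail σ x) (∂ P) Q)

  Sat : Seq M → Pred M 0ℓ → Pred M 0ℓ → Set₂
  Sat τ P Q = Σ (Seq M → Pred M 0ℓ → Pred M 0ℓ → Set₁) λ R →
    (∀ σ P′ Q′ → R σ P′ Q′ → SatF R σ P′ Q′) × R τ P Q

  ValidF : (Pred M 0ℓ → Pred M 0ℓ → Set₁) → (Pred M 0ℓ → Pred M 0ℓ → Set₁)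
  ValidF R P Q = (P ⊆ Q) ⊎ (Runnable (P ∖ Q) × R (∂ (P ∖ Q)) Q)

  Valid : Pred M 0ℓ → Pred M 0ℓ → Set₂
  Valid P Q = Σ (Pred M 0ℓ → Pred M 0ℓ → Set₁) λ R →
    (∀ P′ Q′ → R P′ Q′ → ValidF R P′ Q′) × R P Q

{-# OPTIONS --safe #-}
module Submission where

-- Soundness: a post-fixed point R of the Subsumption/Step operator containing (P, Q)
-- is turned into one for path satisfaction by remembering, along a path, a
-- precondition P₀ with R P₀ Q that is smaller than the current precondition.
-- Completeness: if every path from P satisfies P ⇒ Q, the same holds for the
-- frontier ∂(P ∖ Q) (prepend the step into it), hence for all iterated frontiers;
-- classically each of them is either inside Q or runnable, since an irreducible
-- state outside Q would be a one-state path violating P ⇒ Q.  The iterated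
-- frontiers then form a post-fixed point for validity.

open import Defs
open import Level using (0ℓ; Lift; lift)
import Level
open import Relation.Unary using (Pred; _∈_; _∉_; _⊆_)
open import Function.Bundles using (_⇔_; mk⇔)
open import Axiom.ExcludedMiddle using (ExcludedMiddle)
open import Data.Nat using (ℕ; zero; suc)
open import Data.Maybe using (Maybe; just; nothing)
open import Data.Product using (Σ; ∃; _×_; _,_)
open import Data.Sum using (_⊎_; inj₁; inj₂)
open import Data.Empty using (⊥-elim)
open import Relation.Nullary using (yes; no)
open import Relation.Binary.PropositionalEquality using (_≡_; refl; subst; sym)

_·_ : {M : Set} → M → Seq M → Seq M
γ · τ = mkSeq γ rest′ closed′
  where
  rest′ : ℕ → Maybe _
  rest′ zero    = just (hd τ)
  rest′ (suc n) = rest τ n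
  closed′ : ∀ n → rest′ n ≡ nothing → rest′ (suc n) ≡ nothing
  closed′ zero    ()
  closed′ (suc n) e = closed τ n e

module _ {M : Set} (_⟶_ : M → M → Set) where

  PathsSatisfy : Pred M 0ℓ → Pred M 0ℓ → Set₂
  PathsSatisfy P Q = ∀ (τ : Seq M) → IsPath _⟶_ τ → hd τ ∈ P → Sat _⟶_ τ P Q

  frontier : Pred M 0ℓ → Pred M 0ℓ → ℕ → Pred M 0ℓ
  frontier P Q zero    = P
  frontier P Q (suc n) = ∂ _⟶_ (_∖_ _⟶_ (frontier P Q n) Q)

  [_]-isPath : ∀ γ → Irreducible _⟶_ γ → IsPath _⟶_ [ γ ]
  [ γ ]-isPath irr = R , unfold , lift refl
    where
    R : Seq M → Set₁
    R σ = Lift (Level.suc 0ℓ) (σ ≡ [ γ ])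
    unfold : ∀ σ → R σ → PathF _⟶_ R σ
    unfold σ (lift refl) = inj₁ (refl , irr)

  ·-isPath : ∀ γ τ → γ ⟶ hd τ → IsPath _⟶_ τ → IsPath _⟶_ (γ · τ)
  ·-isPath γ τ γ⟶τ (R₀ , unfold₀ , r₀) = R , unfold , inj₁ (lift refl)
    where
    R : Seq M → Set₁
    R σ = Lift (Level.suc 0ℓ) (σ ≡ γ · τ) ⊎ R₀ σ
    unfold : ∀ σ → R σ → PathF _⟶_ R σ
    unfold σ (inj₁ (lift σ≡γ·τ)) =
      subst (PathF _⟶_ R) (sym σ≡γ·τ) (inj₂ (hd τ , refl , γ⟶τ , inj₂ r₀))
    unfold σ (inj₂ r) with unfold₀ σ r
    ... | inj₁ end                     = inj₁ end
    ... | inj₂ (x , eq , σ⟶x , r′) = inj₂ (x , eq , σ⟶x , inj₂ r′)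

  Sat-step : ∀ {τ P Q} → Sat _⟶_ τ P Q → hd τ ∉ Q →
             ∃ λ x → rest τ 0 ≡ just x × hd τ ⟶ x × Sat _⟶_ (tail τ x) (∂ _⟶_ P) Q
  Sat-step {τ} {P} {Q} (R , unfold , r) τ∉Q with unfold τ P Q r
  ... | inj₁ (_ , τ∈Q)                 = ⊥-elim (τ∉Q τ∈Q)
  ... | inj₂ (x , eq , _ , τ⟶x , r′) = x , eq , τ⟶x , (R , unfold , r′)

  Sat-change-pre : ∀ {τ P₁ P₂ Q} → Sat _⟶_ τ P₁ Q → hd τ ∈ P₂ → Sat _⟶_ τ P₂ Q
  Sat-change-pre {τ} {P₁} (R₀ , unfold₀ , r₀) τ∈P₂ = R , unfold , (P₁ , r₀ , τ∈P₂)
    where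
    R : Seq M → Pred M 0ℓ → Pred M 0ℓ → Set₁
    R σ P′ Q′ = Σ (Pred M 0ℓ) λ P₀ → R₀ σ P₀ Q′ × hd σ ∈ P′
    unfold : ∀ σ P′ Q′ → R σ P′ Q′ → SatF _⟶_ R σ P′ Q′
    unfold σ P′ Q′ (P₀ , r , σ∈P′) with unfold₀ σ P₀ Q′ r
    ... | inj₁ (_ , σ∈Q′)                = inj₁ (σ∈P′ , σ∈Q′)
    ... | inj₂ (x , eq , _ , σ⟶x , r′) =
      inj₂ (x , eq , σ∈P′ , σ⟶x , (∂ _⟶_ P₀ , r′ , (hd σ , σ∈P′ , σ⟶x)))

  Valid⇒PathsSatisfy : ∀ (em : ExcludedMiddle 0ℓ) {P Q} → Valid _⟶_ P Q → PathsSatisfy P Q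
  Valid⇒PathsSatisfy em {P} {Q} (V , stepV , v) τ (Π , unfoldΠ , π) τ∈P =
    R , unfold , (P , v , (λ γ∈P → γ∈P) , π , τ∈P)
    where
    R : Seq M → Pred M 0ℓ → Pred M 0ℓ → Set₁
    R σ P′ Q′ = Σ (Pred M 0ℓ) λ P₀ → V P₀ Q′ × P₀ ⊆ P′ × Π σ × hd σ ∈ P₀
    unfold : ∀ σ P′ Q′ → R σ P′ Q′ → SatF _⟶_ R σ P′ Q′
    unfold σ P′ Q′ (P₀ , v₀ , P₀⊆P′ , πσ , σ∈P₀) with em {hd σ ∈ Q′}
    ... | yes σ∈Q′ = inj₁ (P₀⊆P′ σ∈P₀ , σ∈Q′)
    ... | no σ∉Q′ with stepV P₀ Q′ v₀
    ...   | inj₁ P₀⊆Q′ = ⊥-elim (σ∉Q′ (P₀⊆Q′ σ∈P₀))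
    ...   | inj₂ ((_ , progress) , v₁) with unfoldΠ σ πσ
    ...     | inj₁ (_ , irr) = ⊥-elim (irr (progress (hd σ) (σ∈P₀ , σ∉Q′)))
    ...     | inj₂ (x , eq , σ⟶x , πx) =
      inj₂ (x , eq , P₀⊆P′ σ∈P₀ , σ⟶x ,
            (∂ _⟶_ (_∖_ _⟶_ P₀ Q′) , v₁ , (λ { (γ , (γ∈P₀ , _) , γ⟶) → γ , P₀⊆P′ γ∈P₀ , γ⟶ }) ,
             πx , (hd σ , (σ∈P₀ , σ∉Q′) , σ⟶x)))

  PathsSatisfy-∂ : ∀ {P Q} → PathsSatisfy P Q → PathsSatisfy (∂ _⟶_ (_∖_ _⟶_ P Q)) Q
  PathsSatisfy-∂ sat τ isPath τ∈∂@(γ , (γ∈P , γ∉Q) , γ⟶τ)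
    with Sat-step (sat (γ · τ) (·-isPath γ τ γ⟶τ isPath) γ∈P) γ∉Q
  ... | _ , refl , _ , satτ = Sat-change-pre satτ τ∈∂

  PathsSatisfy-frontier : ∀ {P Q} → PathsSatisfy P Q → ∀ n → PathsSatisfy (frontier P Q n) Q
  PathsSatisfy-frontier sat zero    = sat
  PathsSatisfy-frontier sat (suc n) = PathsSatisfy-∂ (PathsSatisfy-frontier sat n)

  PathsSatisfy⇒progress : ExcludedMiddle 0ℓ → ∀ {P Q} → PathsSatisfy P Q →
                          ∀ γ → γ ∈ _∖_ _⟶_ P Q → ∃ λ γ′ → γ ⟶ γ′
  PathsSatisfy⇒progress em sat γ (γ∈P , γ∉Q) with em {∃ λ γ′ → γ ⟶ γ′}
  ... | yes progress = progress
  ... | no irr with Sat-step (sat [ γ ] ([ γ ]-isPath irr) γ∈P) γ∉Q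
  ...   | _ , () , _

  covered-or-runnable : ExcludedMiddle 0ℓ → ∀ {P Q} →
                        (∀ γ → γ ∈ _∖_ _⟶_ P Q → ∃ λ γ′ → γ ⟶ γ′) →
                        P ⊆ Q ⊎ Runnable _⟶_ (_∖_ _⟶_ P Q)
  covered-or-runnable em {P} {Q} progress with em {∃ λ γ → γ ∈ _∖_ _⟶_ P Q}
  ... | yes witness = inj₂ (witness , progress)
  ... | no none     = inj₁ covered
    where
    covered : P ⊆ Q
    covered {γ} γ∈P with em {γ ∈ Q}
    ... | yes γ∈Q = γ∈Q
    ... | no γ∉Q  = ⊥-elim (none (γ , γ∈P , γ∉Q))

  Valid-by-frontier : ∀ {P Q} →
                      (∀ n → frontier P Q n ⊆ Q ⊎ Runnable _⟶_ (_∖_ _⟶_ (frontier P Q n) Q)) →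
                      Valid _⟶_ P Q
  Valid-by-frontier {P} {Q} rule = V , unfold , (zero , refl , lift refl)
    where
    V : Pred M 0ℓ → Pred M 0ℓ → Set₁
    V P′ Q′ = Σ ℕ λ n → P′ ≡ frontier P Q n × Lift (Level.suc 0ℓ) (Q′ ≡ Q)
    unfold : ∀ P′ Q′ → V P′ Q′ → ValidF _⟶_ V P′ Q′
    unfold _ _ (n , refl , lift refl) with rule n
    ... | inj₁ covered  = inj₁ covered
    ... | inj₂ runnable = inj₂ (runnable , (suc n , refl , lift refl))

proposition1 : ExcludedMiddle 0ℓ →
    (M : Set) (_⟶_ : M → M → Set) (P Q : Pred M 0ℓ) →
    Valid _⟶_ P Q ⇔ (∀ (τ : Seq M) → IsPath _⟶_ τ → hd τ ∈ P → Sat _⟶_ τ P Q)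
proposition1 em M _⟶_ P Q = mk⇔ (Valid⇒PathsSatisfy _⟶_ em) complete
  where
  complete : PathsSatisfy _⟶_ P Q → Valid _⟶_ P Q
  complete sat = Valid-by-frontier _⟶_ λ n →
    covered-or-runnable _⟶_ em
      (PathsSatisfy⇒progress _⟶_ em (PathsSatisfy-frontier _⟶_ sat n))
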